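{- Let $G$ be a 2-connected outerplanar near-triangulation with $V(G)=\{u,v_1,\dots,v_k\}$, $k>1$, $N_G(u)=\{v_1,\dots,v_k\}$ and $\deg_G(v_1)=\deg_G(v_k)=2$, with $v_1,\dots,v_k$ labelled consecutively along the path $G-u$. Then for every $2\le l<k$, $P(G)$ contains a non-vanishing monomial $\eta_l\,u^2v_1^0v_k^0v_l^3\prod_{i\notin\{1,k,l\}}v_i^2$.
   Context: For a graph $G$, vertices are also variables and $P(G)=\prod_{xy\in E(G),\,x<y}(x-y)$ for a fixed arbitrary orientation; a monomial is non-vanishing if its coefficient is nonzero. A 2-connected outerplanar near-triangulation is a 2-connected outerplanar graph embedded with all vertices on the outer cycle and all bounded faces triangles. -}

module Defs where

open import Data.Nat as ℕ using (ℕ; zero; suc)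
open import Data.Integer as ℤ using (ℤ)
open import Data.Fin using (Fin; zero; suc; toℕ)
open import Data.Vec using (Vec; tabulate; zipWith; replicate)
open import Data.Vec.Properties using () renaming (≡-dec to vec≡-dec)
open import Data.List using (List; []; _∷_; _++_; map; concatMap; foldr; allFin)
open import Data.Product using (_×_; _,_)
open import Relation.Nullary using (yes; no)

-- Multivariate integer polynomials in n variables x_0 … x_{n-1},
-- represented as (unnormalised) lists of terms  c · x^α.

Monomial : ℕ → Set
Monomial n = Vec ℕ n

Poly : ℕ → Set
Poly n = List (ℤ × Monomial n)

one : ∀ {n} → Poly n
one = (ℤ.1ℤ , replicate _ 0) ∷ []

unitExp : ∀ {n} → Fin n → Monomial n
unitExp i = tabulate λ j → isSame i j
  where
  isSame : ∀ {n} → Fin n → Fin n → ℕ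
  isSame zero    zero    = 1
  isSame zero    (suc _) = 0
  isSame (suc _) zero    = 0
  isSame (suc i) (suc j) = isSame i j

diff : ∀ {n} → Fin n → Fin n → Poly n
diff i j = (ℤ.1ℤ , unitExp i) ∷ (ℤ.-1ℤ , unitExp j) ∷ []

_*P_ : ∀ {n} → Poly n → Poly n → Poly n
p *P q = concatMap (λ { (c , α) → map (λ { (d , β) → (c ℤ.* d , zipWith ℕ._+_ α β) }) q }) p

coeff : ∀ {n} → Poly n → Monomial n → ℤ
coeff [] α = ℤ.0ℤ
coeff ((c , β) ∷ p) α with vec≡-dec ℕ._≟_ β α
... | yes _ = c ℤ.+ coeff p α
... | no  _ = coeff p α

-- Graphs on vertex set Fin n given by an edge list of pairs (x , y)
-- with x < y (this fixes the orientation x < y of the paper).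
-- P(G) = ∏_{xy ∈ E(G), x<y} (x - y).

graphPoly : ∀ {n} → List (Fin n × Fin n) → Poly n
graphPoly = foldr (λ { (x , y) acc → diff x y *P acc }) one

-- The graph G of the lemma on V(G) = {u, v_1, …, v_k}, encoded as
-- Fin (suc k) with u = 0 and v_i = i.  Edges: u v_i (1 ≤ i ≤ k), since
-- N_G(u) = {v_1,…,v_k}, and v_i v_{i+1} (1 ≤ i < k), since G - u is the
-- path v_1 v_2 … v_k.

shift : ∀ {m} → Fin (suc m) → Fin (suc (suc m))
shift zero    = zero
shift (suc i) = suc (suc i)

pathEdges : (k : ℕ) → List (Fin (suc k) × Fin (suc k))
pathEdges zero = []
pathEdges (suc zero) = []
pathEdges (suc (suc m)) =
  (suc zero , suc (suc zero)) ∷ map (λ { (x , y) → (shift x , shift y) }) (pathEdges (suc m))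

fanEdges : (k : ℕ) → List (Fin (suc k) × Fin (suc k))
fanEdges k = map (λ i → (zero , suc i)) (allFin k) ++ pathEdges k

targetExp : (k l j : ℕ) → ℕ
targetExp k l zero = 2
targetExp k l (suc j) with suc j ℕ.≟ 1 | suc j ℕ.≟ k | suc j ℕ.≟ l
... | yes _ | _     | _     = 0
... | no _  | yes _ | _     = 0
... | no _  | no _  | yes _ = 3
... | no _  | no _  | no _  = 2

targetMonomial : (k l : ℕ) → Monomial (suc k)
targetMonomial k l = tabulate λ j → targetExp k l (toℕ j)

{-# OPTIONS --safe #-}
-- Expanding P(G) = ∏ (x − y) edge by edge, the coefficient of a monomial is a signed count of
-- the ways to pick one endpoint of every edge so that each vertex is picked as often as its
-- exponent says. For u² v_l³ ∏_{i∉{1,k,l}} v_i² there is exactly one way, so the coefficient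
-- is ±1. Going through the edges in order, every pick is forced: uv_1 gives u (v_1 has
-- exponent 0); uv_i for 1 < i < k gives v_i, since otherwise u is used up and uv_k is left
-- with both exponents 0; uv_k gives u. The path v_1 … v_k must then be oriented towards v_l:
-- left of v_l the left endpoint has exponent 0, and right of v_l picking the right endpoint
-- would leave the left one with exponent 1 and no remaining edge at it.
module Submission where

open import Defs
open import Data.Nat using (ℕ; _<_; _≤_)
open import Data.Integer using (0ℤ)
open import Relation.Binary.PropositionalEquality using (_≢_)

open import Function using (_∘_)
open import Data.Nat using (zero; suc; _+_; _∸_; z≤n; s≤s; _≟_; _≤?_; _<?_)
open import Data.Nat.Properties
  using (+-assoc; +-suc; +-identityʳ; +-cancelˡ-≡; m≤m+n; ≤-refl; ≤-trans; ≤-pred; <⇒≤; <⇒≱; <⇒≢; >⇒≢;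
         n<1+n; m<n⇒m<1+n; <-cmp; <-≤-connex; ≤∧≢⇒<; m≤n⇒m<n∨m≡n; 0∸n≡0; m+[n∸m]≡n; n≢0⇒n>0;
         1+n≢0; 0≢1+n)
open import Data.Integer as ℤ using (ℤ; 1ℤ; -1ℤ; ∣_∣)
open import Data.Integer.Properties as ℤ using ()
open import Data.Fin using (Fin; zero; suc; toℕ)
open import Data.Fin.Properties using (toℕ-injective)
open import Data.Vec using ([]; _∷_; lookup; tabulate; zipWith; replicate)
open import Data.Vec.Properties using (∷-injective; lookup-zipWith; lookup∘tabulate; lookup-replicate)
  renaming (≡-dec to vec≡-dec)
open import Data.List using (List; []; _∷_; _++_; map)
open import Data.List.Properties using (map-tabulate; ++-identityʳ)
open import Data.List.Relation.Unary.All using (All; []; _∷_)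
open import Data.List.Relation.Unary.Any as Any using (Any; here; there)
open import Data.List.Relation.Unary.Any.Properties using (++⁺ˡ)
open import Data.Product as Product using (_×_; _,_; proj₁; proj₂)
open import Data.Sum using (_⊎_; inj₁; inj₂)
open import Relation.Nullary using (yes; no; contradiction)
open import Relation.Binary.Definitions using (Tri; tri<; tri≈; tri>)
open import Relation.Binary.PropositionalEquality
  using (_≡_; refl; sym; trans; cong; cong₂; subst; subst₂; _≗_; module ≡-Reasoning)
open ≡-Reasoning

infixl 6 _+ᵛ_

_+ᵛ_ : ∀ {n} → Monomial n → Monomial n → Monomial n
_+ᵛ_ = zipWith _+_

+ᵛ-cancelˡ : ∀ {n} (γ : Monomial n) {α β : Monomial n} → γ +ᵛ α ≡ γ +ᵛ β → α ≡ β
+ᵛ-cancelˡ [] {[]} {[]} _ = refl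
+ᵛ-cancelˡ (c ∷ γ) {a ∷ α} {b ∷ β} eq =
  let c+a≡c+b , γ+α≡γ+β = ∷-injective eq
  in cong₂ _∷_ (+-cancelˡ-≡ c a b c+a≡c+b) (+ᵛ-cancelˡ γ γ+α≡γ+β)

infixr 7 _⋆_

_⋆_ : ∀ {n} → ℤ × Monomial n → Poly n → Poly n
(c , γ) ⋆ p = map (λ t → (c ℤ.* proj₁ t , γ +ᵛ proj₂ t)) p

diff-*P : ∀ {n} (x y : Fin n) (p : Poly n) →
  diff x y *P p ≡ (1ℤ , unitExp x) ⋆ p ++ (-1ℤ , unitExp y) ⋆ p
diff-*P x y p = cong ((1ℤ , unitExp x) ⋆ p ++_) (++-identityʳ _)

coeff-++ : ∀ {n} (p q : Poly n) α → coeff (p ++ q) α ≡ coeff p α ℤ.+ coeff q α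
coeff-++ [] q α = sym (ℤ.+-identityˡ _)
coeff-++ ((c , β) ∷ p) q α with vec≡-dec _≟_ β α
... | yes _ = trans (cong (λ s → c ℤ.+ s) (coeff-++ p q α)) (sym (ℤ.+-assoc c _ _))
... | no _  = coeff-++ p q α

coeff-⋆-+ᵛ : ∀ {n} c (γ : Monomial n) p α → coeff ((c , γ) ⋆ p) (γ +ᵛ α) ≡ c ℤ.* coeff p α
coeff-⋆-+ᵛ c γ [] α = sym (ℤ.*-zeroʳ c)
coeff-⋆-+ᵛ c γ ((d , β) ∷ p) α with vec≡-dec _≟_ (γ +ᵛ β) (γ +ᵛ α) | vec≡-dec _≟_ β α
... | yes _       | yes _   =
  trans (cong (λ s → c ℤ.* d ℤ.+ s) (coeff-⋆-+ᵛ c γ p α)) (sym (ℤ.*-distribˡ-+ c d _))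
... | yes γ+β≡γ+α | no β≢α  = contradiction (+ᵛ-cancelˡ γ γ+β≡γ+α) β≢α
... | no γ+β≢γ+α  | yes β≡α = contradiction (cong (γ +ᵛ_) β≡α) γ+β≢γ+α
... | no _        | no _    = coeff-⋆-+ᵛ c γ p α

coeff-⋆-< : ∀ {n} c (γ : Monomial n) p {α} (i : Fin n) → lookup α i < lookup γ i →
  coeff ((c , γ) ⋆ p) α ≡ 0ℤ
coeff-⋆-< c γ [] i _ = refl
coeff-⋆-< c γ ((d , β) ∷ p) {α} i α<γ with vec≡-dec _≟_ (γ +ᵛ β) α
... | yes refl =
  contradiction (subst (lookup γ i ≤_) (sym (lookup-zipWith _+_ i γ β)) (m≤m+n _ _)) (<⇒≱ α<γ)
... | no _ = coeff-⋆-< c γ p i α<γ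

coeff-one-0 : ∀ {n} → coeff (one {n}) (replicate n 0) ≡ 1ℤ
coeff-one-0 {n} with vec≡-dec _≟_ (replicate n 0) (replicate n 0)
... | yes _  = refl
... | no 0≢0 = contradiction refl 0≢0

coeff-one-≢ : ∀ {n} {α : Monomial n} → replicate n 0 ≢ α → coeff one α ≡ 0ℤ
coeff-one-≢ {n} {α} 0≢α with vec≡-dec _≟_ (replicate n 0) α
... | yes 0≡α = contradiction 0≡α 0≢α
... | no _    = refl

δ : ℕ → ℕ → ℕ
δ zero    zero    = 1
δ zero    (suc _) = 0
δ (suc _) zero    = 0
δ (suc m) (suc y) = δ m y

δ-same : ∀ m → δ m m ≡ 1
δ-same zero    = refl
δ-same (suc m) = δ-same m

δ-≢ : ∀ {m y} → y ≢ m → δ m y ≡ 0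
δ-≢ {zero}  {zero}  0≢0 = contradiction refl 0≢0
δ-≢ {zero}  {suc y} _   = refl
δ-≢ {suc m} {zero}  _   = refl
δ-≢ {suc m} {suc y} y≢m = δ-≢ (y≢m ∘ cong suc)

infixr 6 _⊕_

_⊕_ : (ℕ → ℕ) → (ℕ → ℕ) → ℕ → ℕ
(f ⊕ g) y = f y + g y

-- The exponents of the quotient by x_m; by truncated subtraction this is f itself if f m ≡ 0.
lower : ℕ → (ℕ → ℕ) → ℕ → ℕ
lower m f y = f y ∸ δ m y

lower-≢ : ∀ {m y} f → y ≢ m → lower m f y ≡ f y
lower-≢ f y≢m = cong (f _ ∸_) (δ-≢ y≢m)

lower-zero : ∀ m f {y} → f y ≡ 0 → lower m f y ≡ 0
lower-zero m f {y} fy≡0 = trans (cong (_∸ δ m y) fy≡0) (0∸n≡0 (δ m y))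

δ⊕lower : ∀ m f → f m ≢ 0 → f ≗ δ m ⊕ lower m f
δ⊕lower m f fm≢0 y = sym (m+[n∸m]≡n δ≤f)
  where
  δ≤f : δ m y ≤ f y
  δ≤f with y ≟ m
  ... | yes refl = subst (_≤ f y) (sym (δ-same y)) (n≢0⇒n>0 fm≢0)
  ... | no y≢m   = subst (_≤ f y) (sym (δ-≢ y≢m)) z≤n

monomial : ∀ {n} → (ℕ → ℕ) → Monomial n
monomial f = tabulate (λ i → f (toℕ i))

lookup-monomial : ∀ {n} f (i : Fin n) → lookup (monomial f) i ≡ f (toℕ i)
lookup-monomial f = lookup∘tabulate _

monomial-cong : ∀ {n f g} → (∀ y → y < n → f y ≡ g y) → monomial {n} f ≡ monomial g
monomial-cong {zero}  _   = refl
monomial-cong {suc n} f≡g = cong₂ _∷_ (f≡g 0 (s≤s z≤n)) (monomial-cong (λ y y<n → f≡g (suc y) (s≤s y<n)))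

monomial-zero : ∀ {n f} → (∀ y → f y ≡ 0) → monomial {n} f ≡ replicate n 0
monomial-zero {zero}  _   = refl
monomial-zero {suc n} f≡0 = cong₂ _∷_ (f≡0 0) (monomial-zero (f≡0 ∘ suc))

monomial-⊕ : ∀ {n} f g → monomial {n} (f ⊕ g) ≡ monomial f +ᵛ monomial g
monomial-⊕ {zero}  f g = refl
monomial-⊕ {suc n} f g = cong (f 0 + g 0 ∷_) (monomial-⊕ (f ∘ suc) (g ∘ suc))

unitExp≡monomial-δ : ∀ {n} (x : Fin n) → unitExp x ≡ monomial (δ (toℕ x))
unitExp≡monomial-δ zero    = refl
unitExp≡monomial-δ (suc x) = cong (0 ∷_) (unitExp≡monomial-δ x)

monomial-δ⊕ : ∀ {n} (z : Fin n) {m} f → toℕ z ≡ m → monomial (δ m ⊕ f) ≡ unitExp z +ᵛ monomial f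
monomial-δ⊕ z f refl =
  trans (monomial-⊕ (δ (toℕ z)) f) (cong (_+ᵛ monomial f) (sym (unitExp≡monomial-δ z)))

graphCoeff : ∀ {n} → List (Fin n × Fin n) → (ℕ → ℕ) → ℤ
graphCoeff E f = coeff (graphPoly E) (monomial f)

graphCoeff-cong : ∀ {n} (E : List (Fin n × Fin n)) f g → (∀ y → y < n → f y ≡ g y) →
  graphCoeff E f ≡ graphCoeff E g
graphCoeff-cong E f g f≡g = cong (coeff (graphPoly E)) (monomial-cong f≡g)

graphCoeff-[] : ∀ {n f} → (∀ y → f y ≡ 0) → graphCoeff {n} [] f ≡ 1ℤ
graphCoeff-[] {n} {f} f≡0 = trans (cong (coeff one) (monomial-zero {n} {f} f≡0)) (coeff-one-0 {n})

graphCoeff-∷ : ∀ {n} (x y : Fin n) E f →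
  graphCoeff ((x , y) ∷ E) f ≡
    coeff ((1ℤ , unitExp x) ⋆ graphPoly E) (monomial f) ℤ.+
    coeff ((-1ℤ , unitExp y) ⋆ graphPoly E) (monomial f)
graphCoeff-∷ x y E f =
  trans (cong (λ p → coeff p (monomial f)) (diff-*P x y (graphPoly E)))
        (coeff-++ ((1ℤ , unitExp x) ⋆ graphPoly E) ((-1ℤ , unitExp y) ⋆ graphPoly E) (monomial f))

coeff-⋆-δ⊕ : ∀ {n} c (z : Fin n) {m} p f f' → toℕ z ≡ m → f ≗ δ m ⊕ f' →
  coeff ((c , unitExp z) ⋆ p) (monomial f) ≡ c ℤ.* coeff p (monomial f')
coeff-⋆-δ⊕ c z {m} p f f' z≡m f≗δ⊕f' = begin
  coeff ((c , unitExp z) ⋆ p) (monomial f)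
    ≡⟨ cong (coeff ((c , unitExp z) ⋆ p)) (monomial-cong (λ y _ → f≗δ⊕f' y)) ⟩
  coeff ((c , unitExp z) ⋆ p) (monomial (δ m ⊕ f'))
    ≡⟨ cong (coeff ((c , unitExp z) ⋆ p)) (monomial-δ⊕ z f' z≡m) ⟩
  coeff ((c , unitExp z) ⋆ p) (unitExp z +ᵛ monomial f')
    ≡⟨ coeff-⋆-+ᵛ c _ p _ ⟩
  c ℤ.* coeff p (monomial f') ∎

coeff-⋆-absent : ∀ {n} c (z : Fin n) p f → f (toℕ z) ≡ 0 → coeff ((c , unitExp z) ⋆ p) (monomial f) ≡ 0ℤ
coeff-⋆-absent c z p f fz≡0 = coeff-⋆-< c (unitExp z) p z (subst₂ _<_ (sym f[z]≡0) (sym e[z]≡1) (s≤s z≤n))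
  where
  f[z]≡0 : lookup (monomial f) z ≡ 0
  f[z]≡0 = trans (lookup-monomial f z) fz≡0
  e[z]≡1 : lookup (unitExp z) z ≡ 1
  e[z]≡1 = trans (cong (λ α → lookup α z) (unitExp≡monomial-δ z))
                 (trans (lookup-monomial (δ (toℕ z)) z) (δ-same (toℕ z)))

-- Picking x_m from an edge in front of E contributes nothing to the coefficient of f.
Blocked : ∀ {n} → List (Fin n × Fin n) → (ℕ → ℕ) → ℕ → Set
Blocked E f m = f m ≡ 0 ⊎ graphCoeff E (lower m f) ≡ 0ℤ

coeff-⋆-blocked : ∀ {n} c (z : Fin n) {m} E f → toℕ z ≡ m → Blocked E f m →
  coeff ((c , unitExp z) ⋆ graphPoly E) (monomial f) ≡ 0ℤ
coeff-⋆-blocked c z E f refl (inj₁ fz≡0) = coeff-⋆-absent c z (graphPoly E) f fz≡0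
coeff-⋆-blocked c z E f refl (inj₂ rest≡0) with f (toℕ z) ≟ 0
... | yes fz≡0 = coeff-⋆-absent c z (graphPoly E) f fz≡0
... | no fz≢0  = begin
  coeff ((c , unitExp z) ⋆ graphPoly E) (monomial f)
    ≡⟨ coeff-⋆-δ⊕ c z (graphPoly E) f (lower (toℕ z) f) refl (δ⊕lower _ f fz≢0) ⟩
  c ℤ.* graphCoeff E (lower (toℕ z) f) ≡⟨ cong (c ℤ.*_) rest≡0 ⟩
  c ℤ.* 0ℤ                             ≡⟨ ℤ.*-zeroʳ c ⟩
  0ℤ                                   ∎

graphCoeff-∷-blocked : ∀ {n} (x y : Fin n) E f → Blocked E f (toℕ x) → Blocked E f (toℕ y) →
  graphCoeff ((x , y) ∷ E) f ≡ 0ℤ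
graphCoeff-∷-blocked x y E f x-blocked y-blocked =
  trans (graphCoeff-∷ x y E f)
        (cong₂ ℤ._+_ (coeff-⋆-blocked 1ℤ x E f refl x-blocked) (coeff-⋆-blocked -1ℤ y E f refl y-blocked))

graphCoeff-∷-fst : ∀ {n} (x y : Fin n) {i j} E f f' → toℕ x ≡ i → toℕ y ≡ j →
  f ≗ δ i ⊕ f' → Blocked E f j → graphCoeff ((x , y) ∷ E) f ≡ graphCoeff E f'
graphCoeff-∷-fst x y E f f' x≡i y≡j f≗δ⊕f' y-blocked = begin
  graphCoeff ((x , y) ∷ E) f
    ≡⟨ trans (graphCoeff-∷ x y E f)
             (cong₂ ℤ._+_ (coeff-⋆-δ⊕ 1ℤ x (graphPoly E) f f' x≡i f≗δ⊕f')
                          (coeff-⋆-blocked -1ℤ y E f y≡j y-blocked)) ⟩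
  1ℤ ℤ.* graphCoeff E f' ℤ.+ 0ℤ ≡⟨ ℤ.+-identityʳ _ ⟩
  1ℤ ℤ.* graphCoeff E f'        ≡⟨ ℤ.*-identityˡ _ ⟩
  graphCoeff E f'               ∎

graphCoeff-∷-snd : ∀ {n} (x y : Fin n) {i j} E f f' → toℕ x ≡ i → toℕ y ≡ j →
  f ≗ δ j ⊕ f' → Blocked E f i → graphCoeff ((x , y) ∷ E) f ≡ ℤ.- graphCoeff E f'
graphCoeff-∷-snd x y E f f' x≡i y≡j f≗δ⊕f' x-blocked = begin
  graphCoeff ((x , y) ∷ E) f
    ≡⟨ trans (graphCoeff-∷ x y E f)
             (cong₂ ℤ._+_ (coeff-⋆-blocked 1ℤ x E f x≡i x-blocked)
                          (coeff-⋆-δ⊕ -1ℤ y (graphPoly E) f f' y≡j f≗δ⊕f')) ⟩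
  0ℤ ℤ.+ -1ℤ ℤ.* graphCoeff E f' ≡⟨ ℤ.+-identityˡ _ ⟩
  -1ℤ ℤ.* graphCoeff E f'        ≡⟨ ℤ.-1*i≡-i _ ⟩
  ℤ.- graphCoeff E f'            ∎

Dead : ∀ {n} → (ℕ → ℕ) → Fin n × Fin n → Set
Dead f e = f (toℕ (proj₁ e)) ≡ 0 × f (toℕ (proj₂ e)) ≡ 0

graphCoeff-dead : ∀ {n} (E : List (Fin n × Fin n)) f → Any (Dead f) E → graphCoeff E f ≡ 0ℤ
graphCoeff-dead ((x , y) ∷ E) f (here (fx≡0 , fy≡0)) =
  graphCoeff-∷-blocked x y E f (inj₁ fx≡0) (inj₁ fy≡0)
graphCoeff-dead ((x , y) ∷ E) f (there dead) =
  graphCoeff-∷-blocked x y E f (inj₂ (later (toℕ x))) (inj₂ (later (toℕ y)))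
  where
  later : ∀ m → graphCoeff E (lower m f) ≡ 0ℤ
  later m = graphCoeff-dead E (lower m f) (Any.map (Product.map (lower-zero m f) (lower-zero m f)) dead)

graphCoeff-isolated : ∀ {n} (E : List (Fin n × Fin n)) f (w : Fin n) → f (toℕ w) ≢ 0 →
  All (λ e → proj₁ e ≢ w × proj₂ e ≢ w) E → graphCoeff E f ≡ 0ℤ
graphCoeff-isolated [] f w fw≢0 [] = coeff-one-≢ 0≢f
  where
  0≢f : replicate _ 0 ≢ monomial f
  0≢f 0≡f = fw≢0 (begin
    f (toℕ w)                 ≡⟨ lookup-monomial f w ⟨
    lookup (monomial f) w     ≡⟨ cong (λ α → lookup α w) 0≡f ⟨
    lookup (replicate _ 0) w  ≡⟨ lookup-replicate w 0 ⟩
    0                         ∎)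
graphCoeff-isolated ((x , y) ∷ E) f w fw≢0 ((x≢w , y≢w) ∷ avoid) =
  graphCoeff-∷-blocked x y E f (inj₂ (later x x≢w)) (inj₂ (later y y≢w))
  where
  later : ∀ z → z ≢ w → graphCoeff E (lower (toℕ z) f) ≡ 0ℤ
  later z z≢w = graphCoeff-isolated E (lower (toℕ z) f) w
    (fw≢0 ∘ trans (sym (lower-≢ f (z≢w ∘ toℕ-injective ∘ sym)))) avoid

abstract
  window : ℕ → ℕ → ℕ → ℕ
  window a b y with a ≤? y | y <? b
  ... | yes _ | yes _ = 1
  ... | _     | _     = 0

  window-∈ : ∀ {a b y} → a ≤ y → y < b → window a b y ≡ 1
  window-∈ {a} {b} {y} a≤y y<b with a ≤? y | y <? b
  ... | yes _  | yes _  = refl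
  ... | no a≰y | _      = contradiction a≤y a≰y
  ... | yes _  | no y≮b = contradiction y<b y≮b

  window-< : ∀ {a b y} → y < a → window a b y ≡ 0
  window-< {a} {b} {y} y<a with a ≤? y | y <? b
  ... | yes a≤y | yes _ = contradiction a≤y (<⇒≱ y<a)
  ... | no _    | _     = refl
  ... | yes _   | no _  = refl

  window-≥ : ∀ {a b y} → b ≤ y → window a b y ≡ 0
  window-≥ {a} {b} {y} b≤y with a ≤? y | y <? b
  ... | yes _ | yes y<b = contradiction b≤y (<⇒≱ y<b)
  ... | no _  | _       = refl
  ... | yes _ | no _    = refl

  window-empty : ∀ {a b y} → b ≤ a → window a b y ≡ 0
  window-empty {a} {b} {y} b≤a with a ≤? y | y <? b
  ... | yes a≤y | yes y<b = contradiction (≤-trans b≤a a≤y) (<⇒≱ y<b)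
  ... | no _    | _       = refl
  ... | yes _   | no _    = refl

window-suc : ∀ {a b y} → a < y → window a b y ≡ window (suc a) b y
window-suc {a} {b} {y} a<y with <-≤-connex y b
... | inj₁ y<b = trans (window-∈ (<⇒≤ a<y) y<b) (sym (window-∈ a<y y<b))
... | inj₂ b≤y = trans (window-≥ b≤y) (sym (window-≥ b≤y))

window-peel : ∀ {a b} → a < b → window a b ≗ δ a ⊕ window (suc a) b
window-peel {a} {b} a<b y with <-cmp y a
... | tri< y<a _ _  = trans (window-< y<a) (sym (cong₂ _+_ (δ-≢ (<⇒≢ y<a)) (window-< (m<n⇒m<1+n y<a))))
... | tri≈ _ refl _ = trans (window-∈ ≤-refl a<b) (sym (cong₂ _+_ (δ-same y) (window-< (n<1+n y))))
... | tri> _ _ a<y  = trans (window-suc a<y) (sym (cong (_+ window (suc a) b y) (δ-≢ (>⇒≢ a<y))))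

-- The exponents obtained by orienting the path a — a+1 — … — k towards l.
toward : ℕ → ℕ → ℕ → ℕ → ℕ
toward k a l = window (suc a) (suc l) ⊕ window l k

toward-< : ∀ {k a l y} → y ≤ a → a < l → toward k a l y ≡ 0
toward-< y≤a a<l = cong₂ _+_ (window-< (s≤s y≤a)) (window-< (≤-trans (s≤s y≤a) a<l))

toward-end : ∀ {k a l} → l < k → toward k a l k ≡ 0
toward-end l<k = cong₂ _+_ (window-≥ l<k) (window-≥ ≤-refl)

data IsPath {n} (k : ℕ) : ℕ → List (Fin n × Fin n) → Set where
  []   : IsPath k k []
  edge : ∀ {a x y E} → toℕ x ≡ a → toℕ y ≡ suc a → IsPath k (suc a) E → IsPath k a ((x , y) ∷ E)

IsPath-≤ : ∀ {n k a} {E : List (Fin n × Fin n)} → IsPath k a E → a ≤ k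
IsPath-≤ []              = ≤-refl
IsPath-≤ (edge _ _ path) = <⇒≤ (IsPath-≤ path)

IsPath-avoids : ∀ {n k a} {E : List (Fin n × Fin n)} {w} → IsPath k a E → toℕ w < a →
  All (λ e → proj₁ e ≢ w × proj₂ e ≢ w) E
IsPath-avoids [] _ = []
IsPath-avoids (edge x≡a y≡1+a path) w<a =
  ((λ { refl → <⇒≢ w<a x≡a }) , (λ { refl → <⇒≢ (m<n⇒m<1+n w<a) y≡1+a }))
  ∷ IsPath-avoids path (m<n⇒m<1+n w<a)

path-coeff-start : ∀ {n k a} {E : List (Fin n × Fin n)} → IsPath k a E → ∣ graphCoeff E (window a k) ∣ ≡ 1
path-coeff-start {n} {k} [] = cong ∣_∣ (graphCoeff-[] {n} {window k k} (λ _ → window-empty ≤-refl))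
path-coeff-start {k = k} (edge {x = x} {y} {E} refl y≡1+a path) = begin
  ∣ graphCoeff ((x , y) ∷ E) (window (toℕ x) k) ∣
    ≡⟨ cong ∣_∣ (graphCoeff-∷-fst x y E (window (toℕ x) k) (window (suc (toℕ x)) k) refl y≡1+a
                   (window-peel a<k) (inj₂ x-isolated)) ⟩
  ∣ graphCoeff E (window (suc (toℕ x)) k) ∣
    ≡⟨ path-coeff-start path ⟩
  1 ∎
  where
  a<k : toℕ x < k
  a<k = IsPath-≤ path
  x-kept : lower (suc (toℕ x)) (window (toℕ x) k) (toℕ x) ≡ 1
  x-kept = trans (lower-≢ (window (toℕ x) k) (<⇒≢ (n<1+n (toℕ x)))) (window-∈ ≤-refl a<k)
  x-isolated : graphCoeff E (lower (suc (toℕ x)) (window (toℕ x) k)) ≡ 0ℤ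
  x-isolated = graphCoeff-isolated E (lower (suc (toℕ x)) (window (toℕ x) k)) x
    (1+n≢0 ∘ trans (sym x-kept)) (IsPath-avoids path (n<1+n (toℕ x)))

path-coeff-toward : ∀ {n k a l} {E : List (Fin n × Fin n)} → IsPath k a E → a ≤ l → l ≤ k →
  ∣ graphCoeff E (toward k a l) ∣ ≡ 1
path-coeff-toward path a≤l l≤k with m≤n⇒m<n∨m≡n a≤l
path-coeff-toward {k = k} {a} {E = E} path _ _ | inj₂ refl =
  trans (cong ∣_∣ (graphCoeff-cong E (toward k a a) (window a k)
                     (λ y _ → cong (_+ window a k y) (window-empty {suc a} {suc a} {y} ≤-refl))))
        (path-coeff-start path)
path-coeff-toward [] _ l≤k | inj₁ a<l = contradiction l≤k (<⇒≱ a<l)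
path-coeff-toward {k = k} {a} {l} (edge {x = x} {y} {E} x≡a y≡1+a path) _ l≤k | inj₁ a<l = begin
  ∣ graphCoeff ((x , y) ∷ E) (toward k a l) ∣
    ≡⟨ cong ∣_∣ (graphCoeff-∷-snd x y E (toward k a l) (toward k (suc a) l) x≡a y≡1+a step
                   (inj₁ (toward-< ≤-refl a<l))) ⟩
  ∣ ℤ.- graphCoeff E (toward k (suc a) l) ∣
    ≡⟨ ℤ.∣-i∣≡∣i∣ (graphCoeff E (toward k (suc a) l)) ⟩
  ∣ graphCoeff E (toward k (suc a) l) ∣
    ≡⟨ path-coeff-toward path a<l l≤k ⟩
  1 ∎
  where
  step : toward k a l ≗ δ (suc a) ⊕ toward k (suc a) l
  step v = trans (cong (_+ window l k v) (window-peel (s≤s a<l) v))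
                 (+-assoc (δ (suc a) v) (window (suc (suc a)) (suc l) v) (window l k v))

data IsFan {n} (k : ℕ) : ℕ → List (Fin (suc n) × Fin (suc n)) → Set where
  last : ∀ {y} → toℕ y ≡ k → IsFan k k ((zero , y) ∷ [])
  edge : ∀ {a y E} → toℕ y ≡ a → IsFan k (suc a) E → IsFan k a ((zero , y) ∷ E)

IsFan-≤ : ∀ {n k a} {E : List (Fin (suc n) × Fin (suc n))} → IsFan k a E → a ≤ k
IsFan-≤ (last _)     = ≤-refl
IsFan-≤ (edge _ fan) = <⇒≤ (IsFan-≤ fan)

IsFan-dead : ∀ {n k a} {E : List (Fin (suc n) × Fin (suc n))} {f} → IsFan k a E → f 0 ≡ 0 → f k ≡ 0 →
  Any (Dead f) E
IsFan-dead {f = f} (last y≡k) f0≡0 fk≡0 = here (f0≡0 , trans (cong f y≡k) fk≡0)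
IsFan-dead (edge _ fan)     f0≡0 fk≡0 = there (IsFan-dead fan f0≡0 fk≡0)

fan-coeff : ∀ {n k a} h {E P : List (Fin (suc n) × Fin (suc n))} → IsFan k a E → 0 < a →
  h 0 ≡ 0 → h k ≡ 0 → ∣ graphCoeff (E ++ P) (window a k ⊕ δ 0 ⊕ h) ∣ ≡ ∣ graphCoeff P h ∣
fan-coeff {k = k} h {P = P} (last {y} y≡k) 0<k h0≡0 hk≡0 =
  cong ∣_∣ (graphCoeff-∷-fst zero y P (window k k ⊕ δ 0 ⊕ h) h refl y≡k
              (λ v → cong (_+ (δ 0 v + h v)) (window-empty {k} {k} {v} ≤-refl)) (inj₁ k-absent))
  where
  k-absent : window k k k + (δ 0 k + h k) ≡ 0
  k-absent = cong₂ _+_ (window-empty ≤-refl) (cong₂ _+_ (δ-≢ (>⇒≢ 0<k)) hk≡0)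
fan-coeff {k = k} {a} h {P = P} (edge {y = y} {E} y≡a fan) 0<a h0≡0 hk≡0 = begin
  ∣ graphCoeff ((zero , y) ∷ E ++ P) (window a k ⊕ δ 0 ⊕ h) ∣
    ≡⟨ cong ∣_∣ (graphCoeff-∷-snd zero y (E ++ P) (window a k ⊕ δ 0 ⊕ h) (window (suc a) k ⊕ δ 0 ⊕ h)
                   refl y≡a step (inj₂ centre-exhausted)) ⟩
  ∣ ℤ.- graphCoeff (E ++ P) (window (suc a) k ⊕ δ 0 ⊕ h) ∣
    ≡⟨ ℤ.∣-i∣≡∣i∣ (graphCoeff (E ++ P) (window (suc a) k ⊕ δ 0 ⊕ h)) ⟩
  ∣ graphCoeff (E ++ P) (window (suc a) k ⊕ δ 0 ⊕ h) ∣
    ≡⟨ fan-coeff h {P = P} fan (s≤s z≤n) h0≡0 hk≡0 ⟩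
  ∣ graphCoeff P h ∣ ∎
  where
  a<k : a < k
  a<k = IsFan-≤ fan
  step : window a k ⊕ δ 0 ⊕ h ≗ δ a ⊕ window (suc a) k ⊕ δ 0 ⊕ h
  step v = trans (cong (_+ (δ 0 v + h v)) (window-peel a<k v))
                 (+-assoc (δ a v) (window (suc a) k v) (δ 0 v + h v))
  f : ℕ → ℕ
  f = window a k ⊕ δ 0 ⊕ h
  centre-exhausted : graphCoeff (E ++ P) (lower 0 f) ≡ 0ℤ
  centre-exhausted = graphCoeff-dead (E ++ P) (lower 0 f) (++⁺ˡ (IsFan-dead {f = lower 0 f} fan
    (cong (_∸ 1) (cong₂ _+_ (window-< {a} {k} 0<a) (cong suc h0≡0)))
    (lower-zero 0 f (cong₂ _+_ (window-≥ {a} {k} {k} ≤-refl)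
                               (cong₂ _+_ (δ-≢ (>⇒≢ (≤-trans 0<a (<⇒≤ a<k)))) hk≡0)))))

shiftEdge : ∀ {m} → Fin (suc m) × Fin (suc m) → Fin (suc (suc m)) × Fin (suc (suc m))
shiftEdge e = (shift (proj₁ e) , shift (proj₂ e))

toℕ-shift : ∀ {m} {x : Fin (suc m)} {c} → toℕ x ≡ suc c → toℕ (shift x) ≡ suc (suc c)
toℕ-shift {x = suc _} x≡1+c = cong suc x≡1+c

IsPath-shift : ∀ {m k a} {E : List (Fin (suc m) × Fin (suc m))} → IsPath k (suc a) E →
  IsPath (suc k) (suc (suc a)) (map shiftEdge E)
IsPath-shift []                  = []
IsPath-shift (edge x≡ y≡ path) = edge (toℕ-shift x≡) (toℕ-shift y≡) (IsPath-shift path)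

pathEdges-isPath : ∀ m → IsPath (suc m) 1 (pathEdges (suc m))
pathEdges-isPath zero    = []
pathEdges-isPath (suc m) = edge refl refl (IsPath-shift (pathEdges-isPath m))

tabulate-isFan : ∀ {n} m a (g : Fin (suc m) → Fin (suc n)) → (∀ i → toℕ (g i) ≡ a + toℕ i) →
  IsFan (a + m) a (Data.List.tabulate (λ i → (zero , g i)))
tabulate-isFan zero a g g≡ =
  subst (λ k → IsFan k a (Data.List.tabulate (λ i → (zero , g i)))) (sym (+-identityʳ a))
        (last (trans (g≡ zero) (+-identityʳ a)))
tabulate-isFan (suc m) a g g≡ =
  edge (trans (g≡ zero) (+-identityʳ a))
       (subst (λ k → IsFan k (suc a) (Data.List.tabulate (λ i → (zero , g (suc i))))) (sym (+-suc a m))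
              (tabulate-isFan m (suc a) (g ∘ suc) (λ i → trans (g≡ (suc i)) (+-suc a (toℕ i)))))

-- u is picked by uv_1 and uv_k, v_i by uv_i for 1 < i < k, and the path v_1 … v_k points to v_l.
targetExp-split : ∀ {k l} → 2 ≤ l → l < k → ∀ y → y ≤ k →
  targetExp k l y ≡ (δ 0 ⊕ window 2 k ⊕ δ 0 ⊕ toward k 1 l) y
targetExp-split 2≤l l<k zero _ =
  sym (cong suc (cong₂ _+_ (window-< (s≤s z≤n)) (cong suc (toward-< z≤n 2≤l))))
targetExp-split {k} {l} 2≤l l<k (suc j) y≤k with suc j ≟ 1 | suc j ≟ k | suc j ≟ l
... | yes refl | _ | _ =
  sym (cong₂ _+_ (window-< ≤-refl) (toward-< ≤-refl 2≤l))
... | no _ | yes refl | _ =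
  sym (cong₂ _+_ (window-≥ ≤-refl) (toward-end l<k))
... | no _ | no _ | yes refl =
  sym (cong₂ _+_ (window-∈ 2≤l l<k) (cong₂ _+_ (window-∈ 2≤l ≤-refl) (window-∈ ≤-refl l<k)))
... | no y≢1 | no y≢k | no y≢l = sym (cong₂ _+_ (window-∈ 2≤y y<k) (toward-inner (<-cmp (suc j) l)))
  where
  2≤y : 2 ≤ suc j
  2≤y = ≤∧≢⇒< (s≤s z≤n) (y≢1 ∘ sym)
  y<k : suc j < k
  y<k = ≤∧≢⇒< y≤k y≢k
  toward-inner : Tri (suc j < l) (suc j ≡ l) (l < suc j) → toward k 1 l (suc j) ≡ 1
  toward-inner (tri< y<l _ _) = cong₂ _+_ (window-∈ 2≤y (m<n⇒m<1+n y<l)) (window-< y<l)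
  toward-inner (tri≈ _ y≡l _) = contradiction y≡l y≢l
  toward-inner (tri> _ _ l<y) = cong₂ _+_ (window-≥ l<y) (window-∈ (<⇒≤ l<y) y<k)

spokes : ∀ m → List (Fin (suc (suc (suc m))) × Fin (suc (suc (suc m))))
spokes m = map (λ i → (zero , suc i)) (Data.List.tabulate {n = suc m} suc)

spokes-isFan : ∀ m → IsFan (suc (suc m)) 2 (spokes m)
spokes-isFan m = subst (IsFan (suc (suc m)) 2) (sym (map-tabulate suc (λ i → (zero , suc i))))
                       (tabulate-isFan m 2 (λ i → suc (suc i)) (λ _ → refl))

lemma4p4 : (k : ℕ) → 1 < k → (l : ℕ) → 2 ≤ l → l < k →
    coeff (graphPoly (fanEdges k)) (targetMonomial k l) ≢ 0ℤ
lemma4p4 (suc zero) (s≤s ()) _ _ _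
lemma4p4 (suc (suc m)) _ l 2≤l l<k coeff≡0 = 0≢1+n (trans (sym (cong ∣_∣ coeff≡0)) unit)
  where
  k : ℕ
  k = suc (suc m)
  remaining : ℕ → ℕ
  remaining = window 2 k ⊕ δ 0 ⊕ toward k 1 l
  v₁-absent : remaining 1 ≡ 0
  v₁-absent = cong₂ _+_ (window-< {2} {k} ≤-refl) (toward-< ≤-refl 2≤l)
  unit : ∣ graphCoeff (fanEdges k) (targetExp k l) ∣ ≡ 1
  unit = begin
    ∣ graphCoeff (fanEdges k) (targetExp k l) ∣
      ≡⟨ cong ∣_∣ (graphCoeff-cong (fanEdges k) (targetExp k l) (δ 0 ⊕ remaining)
                     (λ y y<1+k → targetExp-split 2≤l l<k y (≤-pred y<1+k))) ⟩
    ∣ graphCoeff ((zero , suc zero) ∷ spokes m ++ pathEdges k) (δ 0 ⊕ remaining) ∣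
      ≡⟨ cong ∣_∣ (graphCoeff-∷-fst zero (suc zero) (spokes m ++ pathEdges k) (δ 0 ⊕ remaining) remaining
                     refl refl (λ _ → refl) (inj₁ v₁-absent)) ⟩
    ∣ graphCoeff (spokes m ++ pathEdges k) remaining ∣
      ≡⟨ fan-coeff (toward k 1 l) (spokes-isFan m) (s≤s z≤n) (toward-< z≤n 2≤l) (toward-end l<k) ⟩
    ∣ graphCoeff (pathEdges k) (toward k 1 l) ∣
      ≡⟨ path-coeff-toward (pathEdges-isPath (suc m)) (<⇒≤ 2≤l) (<⇒≤ l<k) ⟩
    1 ∎
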